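{- Let $q$ be a prime, $k\ge1$, and $\mathcal G=(V,\le,E)$ an undirected, linearly ordered finite graph with $\mathrm{con}(\mathcal G)>k$. Then for all $\vec d,\vec d_*\in\{0,\dots,q-1\}^V$ we have $\mathrm{CFI}_q(\mathcal G,\vec d)\equiv^C_k\mathrm{CFI}_q(\mathcal G,\vec d_*)$. Consequently, for every class $\mathfrak G$ of undirected, linearly ordered graphs with $\mathrm{con}(\mathfrak G)\in\omega(1)$, the class $\mathcal K_q=\{\mathrm{CFI}_q(\mathcal G,\vec d):\mathcal G=(V,\le,E)\in\mathfrak G,\ \vec d\in\{0,\dots,q-1\}^V\}$ has the property that for every $k\ge1$ there exist $\mathfrak A,\mathfrak B\in\mathcal K_q$ with $\mathfrak A\not\cong\mathfrak B$ and $\mathfrak A\equiv^C_k\mathfrak B$.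
   Context: $\mathrm{con}(\mathcal G)$ is the maximal $k\ge1$ such that $\mathcal G$ has more than $k$ vertices and stays connected after deleting any at most $k$ vertices; for a class $\mathfrak G$, $\mathrm{con}(\mathfrak G)$ is the function $n\mapsto\min\{\mathrm{con}(\mathcal G):\mathcal G\in\mathfrak G,\ |\mathcal G|=n\}$. $\equiv^C_k$ denotes equivalence in $C^k_{\infty\omega}$ (infinitary logic with counting quantifiers, at most $k$ variables). $E$ is regarded as a set of directed edges ($(v,w)$ and $(w,v)$ for each undirected edge; $e^{ -1}$ is the reverse of $e$); $E(v)$ is the set of directed edges starting at $v$; arithmetic is mod $q$. $\mathrm{CFI}_q(\mathcal G,\vec d)$ is the structure with signature $\{\preceq,C,I,R\}$ whose universe consists of edge nodes $e_0,\dots,e_{q-1}$ for each directed edge $e$, and for each $v\in V$ the equation class of all $\rho:E(v)\to\{0,\dots,q-1\}$ with $\sum_{e\in E(v)}\rho(e)=\vec d(v)$; $\preceq$ orders edge classes by the linear order on $E$ induced by $\le$, equation classes by $\le$ on $V$, edge nodes before equation nodes (same class = equivalent); $C=\{(e_i,e_{i+1})\}$; $I=\{(e_x,f_y): f=e^{ -1},\ x+y=0\}$; $R=\{(\rho,e_{\rho(e)}): \rho$ in the equation class of $v$, $e\in E(v)\}$. -}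

module Defs where

open import Level using (0ℓ)
open import Data.Nat as ℕ using (ℕ; zero; suc; _+_; _<_; _≤_; NonZero)
open import Data.Nat.DivMod using (_%_)
open import Data.Bool using (Bool; true; false; if_then_else_; _∨_; not)
open import Data.Fin as Fin using (Fin; toℕ)
open import Data.Fin.Subset using (Subset; _∉_; ∣_∣)
open import Data.Vec using (Vec; lookup)
open import Data.List using (List; map; allFin)
open import Data.Nat.ListAction using (sum)
open import Data.Bool.ListAction using (all)
open import Data.Product using (Σ; ∃; _×_; _,_; proj₁; proj₂; swap)
open import Data.Sum using (_⊎_; inj₁; inj₂)
open import Data.Unit using (⊤)
open import Data.Empty using (⊥)
open import Relation.Nullary using (¬_)
open import Relation.Binary.PropositionalEquality using (_≡_; _≢_)
open import Function.Bundles using (_↔_; Inverse; _⇔_)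
open import Function.Definitions using (Injective)

-- Undirected, linearly ordered finite simple graphs.
-- Vertex set V = Fin n, linearly ordered by the usual order on Fin n.

record Graph (n : ℕ) : Set where
  field
    adj    : Fin n → Fin n → Bool
    sym    : ∀ v w → adj v w ≡ adj w v
    irrefl : ∀ v → adj v v ≡ false
open Graph public

module _ {n : ℕ} (G : Graph n) where

  data PathAvoiding (S : Subset n) : Fin n → Fin n → Set where
    here : ∀ {v} → PathAvoiding S v v
    step : ∀ {u w v} → adj G u w ≡ true → w ∉ S →
           PathAvoiding S w v → PathAvoiding S u v

  ConnectedWithout : Subset n → Set
  ConnectedWithout S = ∀ u v → u ∉ S → v ∉ S → PathAvoiding S u v

  StaysConnected : ℕ → Set
  StaysConnected k = k < n × (∀ (S : Subset n) → ∣ S ∣ ≤ k → ConnectedWithout S)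

  IsCon : ℕ → Set
  IsCon c = 1 ≤ c × StaysConnected c × (∀ c′ → c < c′ → ¬ StaysConnected c′)

  ConGreater : ℕ → Set
  ConGreater k = Σ ℕ λ c → IsCon c × k < c

data Sym : Set where
  ≼ₛ Cₛ Iₛ Rₛ : Sym

record Structure : Set₁ where
  field
    U   : Set
    rel : Sym → U → U → Set
open Structure public

record _≅_ (A B : Structure) : Set where
  field
    bij   : U A ↔ U B
    preserves : ∀ s a b →
      rel A s a b ⇔ rel B s (Inverse.to bij a) (Inverse.to bij b)

data Form (k : ℕ) : Set₁ where
  atom : Sym → Fin k → Fin k → Form k
  eq   : Fin k → Fin k → Form k
  neg  : Form k → Form k
  conj : {I : Set} → (I → Form k) → Form k
  cnt  : ℕ → Fin k → Form k → Form k

data Free {k : ℕ} (x : Fin k) : Form k → Set₁ where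
  atomˡ : ∀ {s y z} → x ≡ y → Free x (atom s y z)
  atomʳ : ∀ {s y z} → x ≡ z → Free x (atom s y z)
  eqˡ   : ∀ {y z} → x ≡ y → Free x (eq y z)
  eqʳ   : ∀ {y z} → x ≡ z → Free x (eq y z)
  negF  : ∀ {φ} → Free x φ → Free x (neg φ)
  conjF : ∀ {I} {φ : I → Form k} (i : I) → Free x (φ i) → Free x (conj φ)
  cntF  : ∀ {m y φ} → x ≢ y → Free x φ → Free x (cnt m y φ)

Sentence : {k : ℕ} → Form k → Set₁
Sentence φ = ∀ x → ¬ Free x φ

update : {k : ℕ} {A : Set} → (Fin k → A) → Fin k → A → (Fin k → A)
update α x a y with x Fin.≟ y
... | Relation.Nullary.yes _ = a
... | Relation.Nullary.no  _ = α y

Sat : {k : ℕ} (A : Structure) → (Fin k → U A) → Form k → Set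
Sat A α (atom s x y) = rel A s (α x) (α y)
Sat A α (eq x y)     = α x ≡ α y
Sat A α (neg φ)      = ¬ Sat A α φ
Sat A α (conj φ)     = ∀ i → Sat A α (φ i)
Sat A α (cnt m x φ)  =
  Σ (Fin m → U A) λ f → Injective _≡_ _≡_ f × (∀ j → Sat A (update α x (f j)) φ)

_≡C[_]_ : Structure → ℕ → Structure → Set₁
A ≡C[ k ] B = ∀ (φ : Form k) → Sentence φ →
  ∀ (α : Fin k → U A) (β : Fin k → U B) → (Sat A α φ → Sat B β φ) × (Sat B β φ → Sat A α φ)

module _ {n : ℕ} (G : Graph n) (q : ℕ) .{{_ : NonZero q}} where

  DirEdge : Set
  DirEdge = Σ (Fin n × Fin n) λ p → adj G (proj₁ p) (proj₂ p) ≡ true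

  -- an assignment ρ : E(v) → {0..q-1} is represented by a vector indexed by
  -- the head w of e = (v , w); entries at non-neighbours are required to be 0
  -- (so that representations are unique)
  offZero : Fin n → Vec (Fin q) n → Bool
  offZero v ρ = all (λ w → adj G v w ∨ (toℕ (lookup ρ w) ℕ.≡ᵇ 0)) (allFin n)

  sumE : Fin n → Vec (Fin q) n → ℕ
  sumE v ρ = sum (map (λ w → if adj G v w then toℕ (lookup ρ w) else 0) (allFin n))

  EqNode : (Fin n → Fin q) → Set
  EqNode d = Σ (Fin n) λ v → Σ (Vec (Fin q) n) λ ρ →
             offZero v ρ ≡ true × sumE v ρ % q ≡ toℕ (d v)

  CFIUniv : (Fin n → Fin q) → Set
  CFIUniv d = (DirEdge × Fin q) ⊎ EqNode d

  EdgeLe : DirEdge → DirEdge → Set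
  EdgeLe ((v , w) , _) ((v′ , w′) , _) = v Fin.< v′ ⊎ (v ≡ v′ × w Fin.≤ w′)

  module _ (d : Fin n → Fin q) where
    Prec : CFIUniv d → CFIUniv d → Set
    Prec (inj₁ (e , _)) (inj₁ (f , _)) = EdgeLe e f
    Prec (inj₁ _) (inj₂ _) = ⊤
    Prec (inj₂ _) (inj₁ _) = ⊥
    Prec (inj₂ (v , _)) (inj₂ (u , _)) = v Fin.≤ u

    CRel : CFIUniv d → CFIUniv d → Set
    CRel (inj₁ (e , i)) (inj₁ (f , j)) = proj₁ e ≡ proj₁ f × toℕ j ≡ suc (toℕ i) % q
    CRel _ _ = ⊥

    IRel : CFIUniv d → CFIUniv d → Set
    IRel (inj₁ (e , x)) (inj₁ (f , y)) = proj₁ f ≡ swap (proj₁ e) × (toℕ x + toℕ y) % q ≡ 0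
    IRel _ _ = ⊥

    RRel : CFIUniv d → CFIUniv d → Set
    RRel (inj₂ (v , ρ , _)) (inj₁ (((u , w) , _) , i)) = u ≡ v × i ≡ lookup ρ w
    RRel _ _ = ⊥

    CFI : Structure
    CFI = record { U = CFIUniv d ; rel = λ { ≼ₛ → Prec ; Cₛ → CRel ; Iₛ → IRel ; Rₛ → RRel } }

GraphClass : Set₁
GraphClass = (n : ℕ) → Graph n → Set

-- con(𝔊) ∈ ω(1): 𝔊 contains arbitrarily large graphs, and for every c,
-- for all sufficiently large n, every graph of size n in 𝔊 has con > c
ConOmega1 : GraphClass → Set
ConOmega1 𝔊 =
  (∀ N → Σ ℕ λ n → N ≤ n × Σ (Graph n) λ G → 𝔊 n G) ×
  (∀ c → Σ ℕ λ N → ∀ n → N ≤ n → ∀ (G : Graph n) → 𝔊 n G → ConGreater G c)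

module Submission where

-- A twist t (a residue shift on each directed edge) acts on
-- CFI(G, d) and lands in CFI(G, d*) at every vertex where it is balanced; an
-- antisymmetric twist preserves all relations (Twisting).  Charge can be moved
-- along any path by a twist (PathTwist).  Every C^k-formula is then preserved
-- by induction on its structure (Invariance): the pebbled variables are matched
-- by one antisymmetric twist, and a counting quantifier over x is handled by the
-- bijection which twists each node by a repair of that twist at the node's
-- vertex; repairs exist because the graph stays connected after deleting the
-- at most k - 1 vertices carrying the other pebbles.
--
-- An isomorphism preserves the order of the edge classes, so
-- it maps each edge node into its own class (Rigidity, via rank-fixed); then
-- the images of the zero equation nodes show that the total charge Σ d(v) mod q
-- is an isomorphism invariant (ChargeInvariance).

open import Defs hiding (sym)
open import Level using (0ℓ)
open import Data.Nat as ℕ using (ℕ; zero; suc; _+_; _*_; _∸_; _≤_; _<_; NonZero)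
import Data.Nat.Properties as ℕₚ
open import Data.Nat.DivMod using (_%_; m%n%n≡m%n; %-distribˡ-+; n%n≡0; m<n⇒m%n≡m; m%n<n)
open import Data.Nat.Induction using (<-wellFounded)
open import Data.Nat.Primality using (Prime; prime⇒nonZero; prime⇒nonTrivial)
import Data.Nat.ListAction as List
open import Data.Fin as Fin using (Fin; toℕ; fromℕ<)
import Data.Fin.Properties as Finₚ
open import Data.Fin.Subset using (Subset; _∈_; _∉_; ⊥; ⁅_⁆; _∪_; _-_; ∣_∣)
import Data.Fin.Subset.Properties as Subsetₚ
open import Data.Bool using (true; false; if_then_else_; _∨_)
import Data.Bool.Properties as Boolₚ
import Data.Bool.ListAction as BoolList
open import Data.List using (map; allFin)
import Data.List.Properties as Listₚ
import Data.List.Relation.Unary.All as All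
import Data.List.Relation.Unary.All.Properties as Allₚ
open import Data.Vec using (Vec; []; _∷_; here; there; lookup; tabulate)
open import Data.Vec.Properties using (lookup∘tabulate; tabulate∘lookup; tabulate-cong)
open import Data.Product using (Σ; _×_; _,_; proj₁; proj₂)
open import Data.Product.Properties using (×-≡,≡←≡)
open import Data.Sum using (_⊎_; inj₁; inj₂)
open import Data.Sum.Properties using (inj₁-injective; inj₂-injective)
open import Data.Unit using (tt)
open import Function using (_∘_; id)
open import Function.Bundles using (_⇔_; mk⇔; Equivalence; _↔_; Inverse; mk↔ₛ′)
import Function.Properties.Equivalence as ⇔
open import Relation.Nullary using (¬_; yes; no; does)
open import Relation.Nullary.Negation using (contradiction)
open import Relation.Binary.PropositionalEquality
  using (_≡_; _≢_; refl; sym; trans; cong; cong₂; subst; subst₂; module ≡-Reasoning)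
open import Relation.Binary.Definitions using (tri<; tri≈; tri>)
import Relation.Binary.Construct.On as On
import Relation.Binary.Reasoning.Setoid as SetoidReasoning
open import Induction.WellFounded using (Acc; acc)
import Axiom.UniquenessOfIdentityProofs as UIP
open import Algebra.Bundles using (AbelianGroup)
open import Algebra.Structures using (IsAbelianGroup)
import Algebra.Properties.Group as GroupProperties
import Algebra.Properties.Quasigroup as QuasigroupProperties
import Algebra.Properties.CommutativeSemigroup as SemigroupProperties
import Algebra.Properties.CommutativeMonoid.Sum as MonoidSum
import Algebra.Solver.CommutativeMonoid as MonoidSolver

δ : ∀ {n} → Fin n → Fin n → ℕ → ℕ
δ a u x = if does (a Fin.≟ u) then x else 0

δ-≢ : ∀ {n} {a u : Fin n} x → a ≢ u → δ a u x ≡ 0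
δ-≢ {a = a} {u} x a≢u with a Fin.≟ u
... | yes a≡u = contradiction a≡u a≢u
... | no _ = refl

δ-comm : ∀ {n m} (a u : Fin n) (b w : Fin m) x → δ b w (δ a u x) ≡ δ a u (δ b w x)
δ-comm a u b w x with a Fin.≟ u | b Fin.≟ w
... | yes _ | yes _ = refl
... | yes _ | no _ = refl
... | no _ | yes _ = refl
... | no _ | no _ = refl

-- ℕ modulo q, viewed as an abelian group on ℕ whose equality is
-- "same remainder mod q"; all the arithmetic of the CFI construction
-- happens here.
module Modular (q : ℕ) .{{_ : NonZero q}} where

  infix 4 _≈_
  _≈_ : ℕ → ℕ → Set
  a ≈ b = a % q ≡ b % q

  negate : ℕ → ℕ
  negate a = q ∸ a % q

  %-≈ : ∀ a → a % q ≈ a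
  %-≈ a = m%n%n≡m%n a q

  0%q≡0 : 0 % q ≡ 0
  0%q≡0 = m<n⇒m%n≡m (ℕ.>-nonZero⁻¹ q)

  +-cong-≈ : ∀ {a a′ b b′} → a ≈ a′ → b ≈ b′ → a + b ≈ a′ + b′
  +-cong-≈ {a} {a′} {b} {b′} a≈a′ b≈b′ = begin
    (a + b) % q            ≡⟨ %-distribˡ-+ a b q ⟩
    (a % q + b % q) % q    ≡⟨ cong₂ (λ x y → (x + y) % q) a≈a′ b≈b′ ⟩
    (a′ % q + b′ % q) % q  ≡⟨ %-distribˡ-+ a′ b′ q ⟨
    (a′ + b′) % q          ∎
    where open ≡-Reasoning

  negate-inverseʳ : ∀ a → a + negate a ≈ 0
  negate-inverseʳ a = begin
    (a + negate a) % q      ≡⟨ +-cong-≈ (sym (%-≈ a)) refl ⟩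
    (a % q + negate a) % q  ≡⟨ cong (_% q) (ℕₚ.m+[n∸m]≡n (ℕₚ.<⇒≤ (m%n<n a q))) ⟩
    q % q                   ≡⟨ n%n≡0 q ⟩
    0                       ≡⟨ 0%q≡0 ⟨
    0 % q                   ∎
    where open ≡-Reasoning

  negate-inverseˡ : ∀ a → negate a + a ≈ 0
  negate-inverseˡ a = trans (cong (_% q) (ℕₚ.+-comm (negate a) a)) (negate-inverseʳ a)

  -- (ℕ, ≈, +, 0, negate) is ℤ/qℤ; its library theory supplies cancellation,
  -- rearrangement lemmas, finite sums and a commutative-monoid solver
  isAbelianGroup : IsAbelianGroup _≈_ _+_ 0 negate
  isAbelianGroup = record
    { isGroup = record
      { isMonoid = record
        { isSemigroup = record
          { isMagma = record
            { isEquivalence = record { refl = refl ; sym = sym ; trans = trans }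
            ; ∙-cong = +-cong-≈ }
          ; assoc = λ a b c → cong (_% q) (ℕₚ.+-assoc a b c) }
        ; identity = (λ a → refl) , (λ a → cong (_% q) (ℕₚ.+-identityʳ a)) }
      ; inverse = negate-inverseˡ , negate-inverseʳ
      ; ⁻¹-cong = cong (λ r → (q ∸ r) % q) }
    ; comm = λ a b → cong (_% q) (ℕₚ.+-comm a b) }

  ℤ/q : AbelianGroup 0ℓ 0ℓ
  ℤ/q = record { isAbelianGroup = isAbelianGroup }

  open AbelianGroup ℤ/q public using (setoid; group; commutativeMonoid; commutativeSemigroup)
  module ≈-Reasoning = SetoidReasoning setoid
  open SemigroupProperties commutativeSemigroup public using (interchange; x∙yz≈y∙xz; x∙yz≈yx∙z)
  open MonoidSum commutativeMonoid public
    using (sum-syntax; ∑-distrib-+) renaming (sum-cong-≋ to ∑-cong; sum-replicate-zero to ∑-zero)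

  +-cancelʳ-≈ : ∀ c a b → a + c ≈ b + c → a ≈ b
  +-cancelʳ-≈ = QuasigroupProperties.cancelʳ (GroupProperties.quasigroup group)

  0ᶠ : Fin q
  0ᶠ = fromℕ< (ℕ.>-nonZero⁻¹ q)

  toℕ-0ᶠ : toℕ 0ᶠ ≡ 0
  toℕ-0ᶠ = Finₚ.toℕ-fromℕ< (ℕ.>-nonZero⁻¹ q)

  -- the conditions in the CFI relations are written with explicit
  -- remainders; they are congruences mod q in disguise
  toℕ-% : (i : Fin q) → toℕ i % q ≡ toℕ i
  toℕ-% i = m<n⇒m%n≡m (Finₚ.toℕ<n i)

  %≡toℕ⇔≈ : ∀ {a} (i : Fin q) → (a % q ≡ toℕ i) ⇔ (a ≈ toℕ i)
  %≡toℕ⇔≈ i = mk⇔ (λ e → trans e (sym (toℕ-% i))) (λ e → trans e (toℕ-% i))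

  toℕ≡%⇔≈ : ∀ {a} (i : Fin q) → (toℕ i ≡ a % q) ⇔ (toℕ i ≈ a)
  toℕ≡%⇔≈ i = mk⇔ (trans (toℕ-% i)) (trans (sym (toℕ-% i)))

  %≡0⇔≈0 : ∀ {a} → (a % q ≡ 0) ⇔ (a ≈ 0)
  %≡0⇔≈0 = mk⇔ (λ e → trans e (sym 0%q≡0)) (λ e → trans e 0%q≡0)

  ≈⇒≡ : {i j : Fin q} → toℕ i ≈ toℕ j → i ≡ j
  ≈⇒≡ {i} {j} e = Finₚ.toℕ-injective (trans (sym (toℕ-% i)) (trans e (toℕ-% j)))

  infixl 6 _⊕_
  _⊕_ : Fin q → ℕ → Fin q
  i ⊕ m = fromℕ< (m%n<n (toℕ i + m) q)

  ⊕-≈ : ∀ i m → toℕ (i ⊕ m) ≈ toℕ i + m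
  ⊕-≈ i m = trans (cong (_% q) (Finₚ.toℕ-fromℕ< (m%n<n (toℕ i + m) q))) (%-≈ (toℕ i + m))

  ≈-resp-⇔ : ∀ {a a′ b b′} → a ≈ a′ → b ≈ b′ → (a ≈ b) ⇔ (a′ ≈ b′)
  ≈-resp-⇔ a≈a′ b≈b′ = mk⇔ (λ e → trans (sym a≈a′) (trans e b≈b′)) (λ e → trans a≈a′ (trans e (sym b≈b′)))

  +-translate-⇔ : ∀ {a b} m → (a ≈ b) ⇔ (a + m ≈ b + m)
  +-translate-⇔ {a} {b} m = mk⇔ (λ e → +-cong-≈ e (refl {x = m % q})) (+-cancelʳ-≈ m a b)

  ⊕-cancelʳ : ∀ {i j} m → i ⊕ m ≡ j ⊕ m → i ≡ j
  ⊕-cancelʳ {i} {j} m e = ≈⇒≡ (+-cancelʳ-≈ m (toℕ i) (toℕ j) (begin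
    toℕ i + m      ≈⟨ ⊕-≈ i m ⟨
    toℕ (i ⊕ m)    ≡⟨ cong toℕ e ⟩
    toℕ (j ⊕ m)    ≈⟨ ⊕-≈ j m ⟩
    toℕ j + m      ∎))
    where open ≈-Reasoning

  ⊕-⊕-inverse : ∀ i {m m′} → m + m′ ≈ 0 → i ⊕ m ⊕ m′ ≡ i
  ⊕-⊕-inverse i {m} {m′} m+m′≈0 = ≈⇒≡ (begin
    toℕ (i ⊕ m ⊕ m′)    ≈⟨ ⊕-≈ (i ⊕ m) m′ ⟩
    toℕ (i ⊕ m) + m′    ≈⟨ +-cong-≈ (⊕-≈ i m) refl ⟩
    toℕ i + m + m′      ≡⟨ ℕₚ.+-assoc (toℕ i) m m′ ⟩
    toℕ i + (m + m′)    ≈⟨ +-cong-≈ {toℕ i} refl m+m′≈0 ⟩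
    toℕ i + 0           ≡⟨ ℕₚ.+-identityʳ (toℕ i) ⟩
    toℕ i               ∎)
    where open ≈-Reasoning

  δ-inverse : ∀ {n} (a u : Fin n) x y → x + y ≈ 0 → δ a u x + δ a u y ≈ 0
  δ-inverse a u x y x+y≈0 with a Fin.≟ u
  ... | yes _ = x+y≈0
  ... | no _ = refl

  listSum-allFin : ∀ m (f : Fin m → ℕ) → List.sum (map f (allFin m)) ≡ ∑[ i < m ] f i
  listSum-allFin m f = trans (cong List.sum (Listₚ.map-tabulate id f)) (tabulated m f)
    where
    tabulated : ∀ m (f : Fin m → ℕ) → List.sum (Data.List.tabulate f) ≡ ∑[ i < m ] f i
    tabulated zero f = refl
    tabulated (suc m) f = cong (f Fin.zero +_) (tabulated m (f ∘ Fin.suc))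

  ∑-δ : ∀ {m} (w : Fin m) x → ∑[ b < m ] δ b w x ≈ x
  ∑-δ {suc m} Fin.zero x = begin
    x + ∑[ b < m ] 0  ≈⟨ +-cong-≈ {x} refl (∑-zero m) ⟩
    x + 0             ≡⟨ ℕₚ.+-identityʳ x ⟩
    x                 ∎
    where open ≈-Reasoning
  ∑-δ {suc m} (Fin.suc w) x = trans (∑-cong {y = λ b → δ b w x} δ-suc) (∑-δ w x)
    where
    δ-suc : ∀ b → δ (Fin.suc b) (Fin.suc w) x ≈ δ b w x
    δ-suc b with b Fin.≟ w
    ... | yes _ = refl
    ... | no _ = refl

  ∑∑-antisymmetric : ∀ m (g : Fin m → Fin m → ℕ) →
    (∀ a b → g a b + g b a ≈ 0) → (∀ a → g a a ≈ 0) → ∑[ a < m ] ∑[ b < m ] g a b ≈ 0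
  ∑∑-antisymmetric zero g anti diag = refl
  ∑∑-antisymmetric (suc m) g anti diag = begin
    (g₀₀ + row) + ∑[ a < m ] (g (Fin.suc a) Fin.zero + ∑[ b < m ] g′ a b)
      ≈⟨ +-cong-≈ {g₀₀ + row} refl (∑-distrib-+ (λ a → g (Fin.suc a) Fin.zero) _) ⟩
    (g₀₀ + row) + (column + rest)   ≈⟨ interchange g₀₀ row column rest ⟩
    (g₀₀ + column) + (row + rest)   ≈⟨ +-cong-≈ (+-cong-≈ (diag Fin.zero) refl) refl ⟩
    column + (row + rest)           ≈⟨ x∙yz≈yx∙z column row rest ⟩
    (row + column) + rest           ≈⟨ +-cong-≈ row+column≈0 (∑∑-antisymmetric m g′ (λ a b → anti _ _) (diag ∘ Fin.suc)) ⟩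
    0                               ∎
    where
    open ≈-Reasoning
    g′ : Fin m → Fin m → ℕ
    g′ a b = g (Fin.suc a) (Fin.suc b)
    g₀₀ row column rest : ℕ
    g₀₀ = g Fin.zero Fin.zero
    row = ∑[ b < m ] g Fin.zero (Fin.suc b)
    column = ∑[ a < m ] g (Fin.suc a) Fin.zero
    rest = ∑[ a < m ] ∑[ b < m ] g′ a b
    row+column≈0 : row + column ≈ 0
    row+column≈0 = begin
      row + column                                                    ≈⟨ ∑-distrib-+ (λ b → g Fin.zero (Fin.suc b)) _ ⟨
      ∑[ b < m ] (g Fin.zero (Fin.suc b) + g (Fin.suc b) Fin.zero)  ≈⟨ ∑-cong (λ b → anti Fin.zero (Fin.suc b)) ⟩
      ∑[ b < m ] 0                                                    ≈⟨ ∑-zero m ⟩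
      0                                                               ∎

cnt-transport : ∀ {k} (A B : Structure) (α : Fin k → U A) (β : Fin k → U B) m x φ (π : U A ↔ U B) →
  (∀ a → Sat A (update α x a) φ ⇔ Sat B (update β x (Inverse.to π a)) φ) →
  Sat A α (cnt m x φ) ⇔ Sat B β (cnt m x φ)
cnt-transport A B α β m x φ π scope = mk⇔
  (λ (as , as-injective , as-sat) →
    to ∘ as , (λ e → as-injective (to-injective e)) , (λ j → Equivalence.to (scope (as j)) (as-sat j)))
  (λ (bs , bs-injective , bs-sat) →
    from ∘ bs , (λ e → bs-injective (from-injective e)) ,
    (λ j → Equivalence.from (scope (from (bs j)))
             (subst (λ b → Sat B (update β x b) φ) (sym (strictlyInverseˡ (bs j))) (bs-sat j))))
  where
  open Inverse π
  to-injective : ∀ {a a′} → to a ≡ to a′ → a ≡ a′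
  to-injective {a} {a′} e = trans (sym (strictlyInverseʳ a)) (trans (cong from e) (strictlyInverseʳ a′))
  from-injective : ∀ {b b′} → from b ≡ from b′ → b ≡ b′
  from-injective {b} {b′} e = trans (sym (strictlyInverseˡ b)) (trans (cong to e) (strictlyInverseˡ b′))

∣p∪q∣≤∣p∣+∣q∣ : ∀ {n} (p r : Subset n) → ∣ p ∪ r ∣ ≤ ∣ p ∣ + ∣ r ∣
∣p∪q∣≤∣p∣+∣q∣ [] [] = ℕ.z≤n
∣p∪q∣≤∣p∣+∣q∣ (true ∷ p) (true ∷ r) = ℕ.s≤s (ℕₚ.≤-trans (∣p∪q∣≤∣p∣+∣q∣ p r) (ℕₚ.+-monoʳ-≤ ∣ p ∣ (ℕₚ.n≤1+n ∣ r ∣)))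
∣p∪q∣≤∣p∣+∣q∣ (true ∷ p) (false ∷ r) = ℕ.s≤s (∣p∪q∣≤∣p∣+∣q∣ p r)
∣p∪q∣≤∣p∣+∣q∣ (false ∷ p) (true ∷ r) = ℕₚ.≤-trans (ℕ.s≤s (∣p∪q∣≤∣p∣+∣q∣ p r)) (ℕₚ.≤-reflexive (sym (ℕₚ.+-suc ∣ p ∣ ∣ r ∣)))
∣p∪q∣≤∣p∣+∣q∣ (false ∷ p) (false ∷ r) = ∣p∪q∣≤∣p∣+∣q∣ p r

∃∉ : ∀ {n} (p : Subset n) → ∣ p ∣ < n → Σ (Fin n) λ v → v ∉ p
∃∉ (false ∷ p) _ = Fin.zero , λ ()
∃∉ (true ∷ p) (ℕ.s≤s ∣p∣<n) = let (v , v∉p) = ∃∉ p ∣p∣<n in Fin.suc v , λ { (there v∈p) → v∉p v∈p }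

∃∉-both : ∀ {n} (S : Subset n) u → suc ∣ S ∣ < n → Σ (Fin n) λ r → r ∉ S × u ≢ r
∃∉-both {n} S u ∣S∣+1<n = r , (λ r∈S → r∉ (Subsetₚ.x∈p∪q⁺ (inj₂ r∈S))) ,
                          (λ u≡r → r∉ (Subsetₚ.x∈p∪q⁺ (inj₁ (subst (_∈ ⁅ u ⁆) u≡r (Subsetₚ.x∈⁅x⁆ u)))))
  where
  bound : ∣ ⁅ u ⁆ ∪ S ∣ < n
  bound = ℕₚ.≤-<-trans (ℕₚ.≤-trans (∣p∪q∣≤∣p∣+∣q∣ ⁅ u ⁆ S)
            (ℕₚ.≤-reflexive (cong (_+ ∣ S ∣) (Subsetₚ.∣⁅x⁆∣≡1 u)))) ∣S∣+1<n
  r : Fin n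
  r = proj₁ (∃∉ (⁅ u ⁆ ∪ S) bound)
  r∉ : r ∉ ⁅ u ⁆ ∪ S
  r∉ = proj₂ (∃∉ (⁅ u ⁆ ∪ S) bound)

x∉p-x : ∀ {n} (p : Subset n) x → x ∉ p - x
x∉p-x (true ∷ p) Fin.zero ()
x∉p-x (false ∷ p) Fin.zero ()
x∉p-x (_ ∷ p) (Fin.suc x) (there x∈p-x) = x∉p-x p x x∈p-x

∣p-x∣<n : ∀ {n} (p : Subset n) x → ∣ p - x ∣ < n
∣p-x∣<n {n} p x = ℕₚ.<-≤-trans (Subsetₚ.p⊂q⇒∣p∣<∣q∣ (Subsetₚ.⊆⊤ , x , Subsetₚ.∈⊤ , x∉p-x p x))
                                (ℕₚ.≤-reflexive (Subsetₚ.∣⊤∣≡n n))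

image : ∀ {k n} → (Fin k → Fin n) → Subset k → Subset n
image h [] = ⊥
image h (false ∷ p) = image (h ∘ Fin.suc) p
image h (true ∷ p) = ⁅ h Fin.zero ⁆ ∪ image (h ∘ Fin.suc) p

∈-image : ∀ {k n} (h : Fin k → Fin n) {p y} → y ∈ p → h y ∈ image h p
∈-image h {true ∷ p} here = Subsetₚ.x∈p∪q⁺ (inj₁ (Subsetₚ.x∈⁅x⁆ (h Fin.zero)))
∈-image h {true ∷ p} (there y∈p) = Subsetₚ.x∈p∪q⁺ (inj₂ (∈-image (h ∘ Fin.suc) y∈p))
∈-image h {false ∷ p} (there y∈p) = ∈-image (h ∘ Fin.suc) y∈p

image-∈⁻ : ∀ {k n} (h : Fin k → Fin n) p {v} → v ∈ image h p → Σ (Fin k) λ y → y ∈ p × h y ≡ v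
image-∈⁻ h [] v∈ = contradiction v∈ Subsetₚ.∉⊥
image-∈⁻ h (false ∷ p) v∈ = let (y , y∈p , hy≡v) = image-∈⁻ (h ∘ Fin.suc) p v∈ in Fin.suc y , there y∈p , hy≡v
image-∈⁻ h (true ∷ p) v∈ with Subsetₚ.x∈p∪q⁻ ⁅ h Fin.zero ⁆ _ v∈
... | inj₁ v∈⁅h0⁆ = Fin.zero , here , sym (Subsetₚ.x∈⁅y⁆⇒x≡y _ v∈⁅h0⁆)
... | inj₂ v∈rest = let (y , y∈p , hy≡v) = image-∈⁻ (h ∘ Fin.suc) p v∈rest in Fin.suc y , there y∈p , hy≡v

∣image∣≤∣p∣ : ∀ {k n} (h : Fin k → Fin n) p → ∣ image h p ∣ ≤ ∣ p ∣
∣image∣≤∣p∣ {n = n} h [] = ℕₚ.≤-reflexive (Subsetₚ.∣⊥∣≡0 n)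
∣image∣≤∣p∣ h (false ∷ p) = ∣image∣≤∣p∣ (h ∘ Fin.suc) p
∣image∣≤∣p∣ h (true ∷ p) = ℕₚ.≤-trans (∣p∪q∣≤∣p∣+∣q∣ ⁅ h Fin.zero ⁆ _)
  (ℕₚ.+-mono-≤ (ℕₚ.≤-reflexive (Subsetₚ.∣⁅x⁆∣≡1 (h Fin.zero))) (∣image∣≤∣p∣ (h ∘ Fin.suc) p))

-- A twist t labels every directed pair (v , w) by a shift t v w; it
-- acts on CFI(G, d) by moving the edge node e_i of e = (v , w) to e_{i + t v w}
-- and shifting the equation nodes accordingly.  The image lies in CFI(G, d*)
-- at every vertex v where t is balanced, i.e. d(v) + ∂ v (t v) ≈ d*(v), and the
-- action preserves all relations when t is antisymmetric.
module Twisting {n : ℕ} (G : Graph n) (q : ℕ) .{{_ : NonZero q}} where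
  open Modular q

  -- an assignment of shifts to the directed pairs; only edges matter
  Twist : Set
  Twist = Fin n → Fin n → ℕ

  -- a twist compatible with I: the shifts of e and e⁻¹ cancel
  Antisymmetric : Twist → Set
  Antisymmetric t = ∀ v w → t v w + t w v ≈ 0

  ∂ : Fin n → (Fin n → ℕ) → ℕ
  ∂ v r = ∑[ w < n ] (if adj G v w then r w else 0)

  -- the shifted equations at v turn charge d(v) into d*(v)
  Balanced : (d d* : Fin n → Fin q) → Twist → Fin n → Set
  Balanced d d* t v = toℕ (d v) + ∂ v (t v) ≈ toℕ (d* v)

  ∂-cong : ∀ v {r r′} → (∀ w → r w ≈ r′ w) → ∂ v r ≈ ∂ v r′
  ∂-cong v r≈r′ = ∑-cong pointwise
    where
    pointwise : ∀ w → (if adj G v w then _ else 0) ≈ (if adj G v w then _ else 0)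
    pointwise w with adj G v w
    ... | true = r≈r′ w
    ... | false = refl

  ∂-+ : ∀ v r r′ → ∂ v (λ w → r w + r′ w) ≈ ∂ v r + ∂ v r′
  ∂-+ v r r′ = trans (∑-cong pointwise) (∑-distrib-+ (λ w → if adj G v w then r w else 0) _)
    where
    pointwise : ∀ w → (if adj G v w then r w + r′ w else 0) ≈
                      (if adj G v w then r w else 0) + (if adj G v w then r′ w else 0)
    pointwise w with adj G v w
    ... | true = refl
    ... | false = refl

  ∂-zero : ∀ v {r} → (∀ w → r w ≈ 0) → ∂ v r ≈ 0
  ∂-zero v {r} r≈0 = trans (∂-cong v r≈0) (trans (∑-cong pointwise) (∑-zero n))
    where
    pointwise : ∀ w → (if adj G v w then 0 else 0) ≈ 0
    pointwise w with adj G v w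
    ... | true = refl
    ... | false = refl

  ∂-δ : ∀ v w c → adj G v w ≡ true → ∂ v (λ b → δ b w c) ≈ c
  ∂-δ v w c vw = trans (∑-cong pointwise) (∑-δ w c)
    where
    pointwise : ∀ b → (if adj G v b then δ b w c else 0) ≈ δ b w c
    pointwise b with b Fin.≟ w
    ... | yes refl rewrite vw = refl
    ... | no _ with adj G v b
    ...   | true = refl
    ...   | false = refl

  vertexOf : ∀ {d} → CFIUniv G q d → Fin n
  vertexOf (inj₁ (((v , _) , _) , _)) = v
  vertexOf (inj₂ (v , _)) = v

  shiftRow : Fin n → (Fin n → ℕ) → Vec (Fin q) n → Vec (Fin q) n
  shiftRow v r ρ = tabulate λ w → if adj G v w then lookup ρ w ⊕ r w else lookup ρ w

  lookup-shiftRow : ∀ v r ρ w → lookup (shiftRow v r ρ) w ≡ (if adj G v w then lookup ρ w ⊕ r w else lookup ρ w)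
  lookup-shiftRow v r ρ w = lookup∘tabulate (λ w → if adj G v w then lookup ρ w ⊕ r w else lookup ρ w) w

  lookup-shiftRow-edge : ∀ v r ρ w → adj G v w ≡ true → lookup (shiftRow v r ρ) w ≡ lookup ρ w ⊕ r w
  lookup-shiftRow-edge v r ρ w vw = trans (lookup-shiftRow v r ρ w) (cong (λ b → if b then lookup ρ w ⊕ r w else lookup ρ w) vw)

  offZero-shiftRow : ∀ v r ρ → offZero G q v (shiftRow v r ρ) ≡ offZero G q v ρ
  offZero-shiftRow v r ρ = cong BoolList.and (Listₚ.map-cong pointwise (allFin n))
    where
    pointwise : ∀ w → (adj G v w ∨ (toℕ (lookup (shiftRow v r ρ) w) ℕ.≡ᵇ 0)) ≡ (adj G v w ∨ (toℕ (lookup ρ w) ℕ.≡ᵇ 0))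
    pointwise w with adj G v w | lookup-shiftRow v r ρ w
    ... | true | _ = refl
    ... | false | e rewrite e = refl

  sumE-shiftRow : ∀ v r ρ → sumE G q v (shiftRow v r ρ) ≈ sumE G q v ρ + ∂ v r
  sumE-shiftRow v r ρ = begin
    sumE G q v (shiftRow v r ρ)                              ≡⟨ listSum-allFin n _ ⟩
    ∑[ w < n ] (if adj G v w then toℕ (lookup (shiftRow v r ρ) w) else 0)
      ≈⟨ ∑-cong pointwise ⟩
    ∑[ w < n ] ((if adj G v w then toℕ (lookup ρ w) else 0) + (if adj G v w then r w else 0))
      ≈⟨ ∑-distrib-+ (λ w → if adj G v w then toℕ (lookup ρ w) else 0) _ ⟩
    ∑[ w < n ] (if adj G v w then toℕ (lookup ρ w) else 0) + ∂ v r
      ≡⟨ cong (_+ ∂ v r) (listSum-allFin n _) ⟨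
    sumE G q v ρ + ∂ v r                                     ∎
    where
    open ≈-Reasoning
    pointwise : ∀ w → (if adj G v w then toℕ (lookup (shiftRow v r ρ) w) else 0) ≈
                      ((if adj G v w then toℕ (lookup ρ w) else 0) + (if adj G v w then r w else 0))
    pointwise w with adj G v w | lookup-shiftRow v r ρ w
    ... | true | e rewrite e = ⊕-≈ (lookup ρ w) (r w)
    ... | false | _ = refl

  twist : ∀ {d d*} (t : Twist) (a : CFIUniv G q d) → Balanced d d* t (vertexOf a) → CFIUniv G q d*
  twist t (inj₁ (((v , w) , vw) , i)) _ = inj₁ (((v , w) , vw) , i ⊕ t v w)
  twist {d} {d*} t (inj₂ (v , ρ , oz , s)) balanced =
    inj₂ (v , shiftRow v (t v) ρ , trans (offZero-shiftRow v (t v) ρ) oz ,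
          Equivalence.from (%≡toℕ⇔≈ (d* v)) (begin
            sumE G q v (shiftRow v (t v) ρ)  ≈⟨ sumE-shiftRow v (t v) ρ ⟩
            sumE G q v ρ + ∂ v (t v)         ≈⟨ +-cong-≈ (Equivalence.to (%≡toℕ⇔≈ (d v)) s) refl ⟩
            toℕ (d v) + ∂ v (t v)            ≈⟨ balanced ⟩
            toℕ (d* v)                       ∎))
    where open ≈-Reasoning

  eqNode-≡ : ∀ {d v ρ ρ′ oz oz′ s s′} → ρ ≡ ρ′ →
    _≡_ {A = CFIUniv G q d} (inj₂ (v , ρ , oz , s)) (inj₂ (v , ρ′ , oz′ , s′))
  eqNode-≡ {oz = oz} {oz′} {s} {s′} refl
    rewrite UIP.Decidable⇒UIP.≡-irrelevant Boolₚ._≟_ oz oz′ | ℕₚ.≡-irrelevant s s′ = refl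

  vec-ext : ∀ {A : Set} {ρ ρ′ : Vec A n} → (∀ w → lookup ρ w ≡ lookup ρ′ w) → ρ ≡ ρ′
  vec-ext {ρ = ρ} {ρ′} e = trans (sym (tabulate∘lookup ρ)) (trans (tabulate-cong e) (tabulate∘lookup ρ′))

  twist-cong : ∀ {d d*} t t′ (a : CFIUniv G q d) p p′ →
    (∀ w → t (vertexOf a) w ≡ t′ (vertexOf a) w) → twist {d} {d*} t a p ≡ twist t′ a p′
  twist-cong t t′ (inj₁ (((v , w) , vw) , i)) p p′ t≡t′ = cong (λ m → inj₁ (((v , w) , vw) , i ⊕ m)) (t≡t′ w)
  twist-cong t t′ (inj₂ (v , ρ , _)) p p′ t≡t′ =
    eqNode-≡ (tabulate-cong λ w → cong (λ m → if adj G v w then lookup ρ w ⊕ m else lookup ρ w) (t≡t′ w))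

  twist-resp : ∀ {d d*} t {a b : CFIUniv G q d} pa pb → a ≡ b → twist {d} {d*} t a pa ≡ twist t b pb
  twist-resp t {a} pa pb refl = twist-cong t t a pa pb (λ _ → refl)

  balanced-cong : ∀ {d d* t t′ v} → (∀ w → t v w ≡ t′ v w) → Balanced d d* t v → Balanced d d* t′ v
  balanced-cong {d} {t = t} {t′} {v} t≡t′ balanced =
    trans (+-cong-≈ {toℕ (d v)} refl (∂-cong v (λ w → cong (_% q) (sym (t≡t′ w))))) balanced

  negateTwist : Twist → Twist
  negateTwist t v w = negate (t v w)

  balanced-negate : ∀ {d d*} t v → Balanced d d* t v → Balanced d* d (negateTwist t) v
  balanced-negate {d} {d*} t v balanced = begin
    toℕ (d* v) + ∂ v (negateTwist t v)                   ≈⟨ +-cong-≈ (sym balanced) refl ⟩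
    (toℕ (d v) + ∂ v (t v)) + ∂ v (negateTwist t v)      ≡⟨ ℕₚ.+-assoc (toℕ (d v)) _ _ ⟩
    toℕ (d v) + (∂ v (t v) + ∂ v (negateTwist t v))      ≈⟨ +-cong-≈ {toℕ (d v)} refl (sym (∂-+ v (t v) _)) ⟩
    toℕ (d v) + ∂ v (λ w → t v w + negate (t v w))       ≈⟨ +-cong-≈ {toℕ (d v)} refl (∂-zero v (λ w → negate-inverseʳ (t v w))) ⟩
    toℕ (d v) + 0                                        ≡⟨ ℕₚ.+-identityʳ _ ⟩
    toℕ (d v)                                            ∎
    where open ≈-Reasoning

  twist-inverse : ∀ {d d*} t t′ → (∀ v w → t v w + t′ v w ≈ 0) → (a : CFIUniv G q d) → ∀ p p′ →
    twist {d*} {d} t′ (twist {d} {d*} t a p) p′ ≡ a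
  twist-inverse t t′ t+t′≈0 (inj₁ (((v , w) , vw) , i)) p p′ =
    cong (λ j → inj₁ (((v , w) , vw) , j)) (⊕-⊕-inverse i (t+t′≈0 v w))
  twist-inverse t t′ t+t′≈0 (inj₂ (v , ρ , _)) p p′ = eqNode-≡ (vec-ext pointwise)
    where
    pointwise : ∀ w → lookup (shiftRow v (t′ v) (shiftRow v (t v) ρ)) w ≡ lookup ρ w
    pointwise w with adj G v w | lookup-shiftRow v (t′ v) (shiftRow v (t v) ρ) w | lookup-shiftRow v (t v) ρ w
    ... | true | e′ | e rewrite e′ | e = ⊕-⊕-inverse (lookup ρ w) (t+t′≈0 v w)
    ... | false | e′ | e rewrite e′ | e = refl

  shiftRow-injective : ∀ v r ρ ρ′ → shiftRow v r ρ ≡ shiftRow v r ρ′ → ρ ≡ ρ′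
  shiftRow-injective v r ρ ρ′ same = vec-ext pointwise
    where
    pointwise : ∀ w → lookup ρ w ≡ lookup ρ′ w
    pointwise w with adj G v w | lookup-shiftRow v r ρ w | lookup-shiftRow v r ρ′ w
    ... | true | e | e′ = ⊕-cancelʳ (r w) (trans (sym e) (trans (cong (λ σ → lookup σ w) same) e′))
    ... | false | e | e′ = trans (sym e) (trans (cong (λ σ → lookup σ w) same) e′)

  twist-injective : ∀ {d d*} t (a b : CFIUniv G q d) p p′ → twist {d} {d*} t a p ≡ twist t b p′ → a ≡ b
  twist-injective t (inj₁ (e , i)) (inj₁ (f , j)) p p′ same with ×-≡,≡←≡ (inj₁-injective same)
  ... | refl , i⊕≡j⊕ = cong (λ k → inj₁ (e , k)) (⊕-cancelʳ _ i⊕≡j⊕)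
  twist-injective t (inj₂ (v , ρ , _)) (inj₂ (v′ , ρ′ , _)) p p′ same with cong proj₁ (inj₂-injective same)
  ... | refl = eqNode-≡ (shiftRow-injective v (t v) ρ ρ′ (cong (proj₁ ∘ proj₂) (inj₂-injective same)))

  successor-shift : ∀ (i j : Fin q) m →
    (toℕ j ≡ suc (toℕ i) % q) ⇔ (toℕ (j ⊕ m) ≡ suc (toℕ (i ⊕ m)) % q)
  successor-shift i j m =
    ⇔.trans (toℕ≡%⇔≈ j) (⇔.trans (+-translate-⇔ m)
      (⇔.trans (≈-resp-⇔ (sym (⊕-≈ j m)) (+-cong-≈ {1} refl (sym (⊕-≈ i m))))
        (⇔.sym (toℕ≡%⇔≈ (j ⊕ m)))))

  inverse-shift : ∀ (i j : Fin q) {m m′} → m + m′ ≈ 0 →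
    ((toℕ i + toℕ j) % q ≡ 0) ⇔ ((toℕ (i ⊕ m) + toℕ (j ⊕ m′)) % q ≡ 0)
  inverse-shift i j {m} {m′} m+m′≈0 =
    ⇔.trans %≡0⇔≈0 (⇔.trans (≈-resp-⇔ (sym shifted-sum) refl) (⇔.sym %≡0⇔≈0))
    where
    open ≈-Reasoning
    shifted-sum : toℕ (i ⊕ m) + toℕ (j ⊕ m′) ≈ toℕ i + toℕ j
    shifted-sum = begin
      toℕ (i ⊕ m) + toℕ (j ⊕ m′)    ≈⟨ +-cong-≈ (⊕-≈ i m) (⊕-≈ j m′) ⟩
      (toℕ i + m) + (toℕ j + m′)    ≈⟨ interchange (toℕ i) m (toℕ j) m′ ⟩
      (toℕ i + toℕ j) + (m + m′)    ≈⟨ +-cong-≈ {toℕ i + toℕ j} refl m+m′≈0 ⟩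
      (toℕ i + toℕ j) + 0           ≡⟨ ℕₚ.+-identityʳ _ ⟩
      toℕ i + toℕ j                 ∎

  twist-preserves : ∀ {d d*} t → Antisymmetric t → ∀ s (a b : CFIUniv G q d) pa pb →
    rel (CFI G q d) s a b ⇔ rel (CFI G q d*) s (twist t a pa) (twist t b pb)
  twist-preserves t anti ≼ₛ (inj₁ _) (inj₁ _) _ _ = ⇔.refl
  twist-preserves t anti ≼ₛ (inj₁ _) (inj₂ _) _ _ = ⇔.refl
  twist-preserves t anti ≼ₛ (inj₂ _) (inj₁ _) _ _ = ⇔.refl
  twist-preserves t anti ≼ₛ (inj₂ _) (inj₂ _) _ _ = ⇔.refl
  twist-preserves t anti Cₛ (inj₁ (((v , w) , _) , i)) (inj₁ (_ , j)) _ _ =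
    mk⇔ (λ { (refl , c) → refl , Equivalence.to (successor-shift i j (t v w)) c })
        (λ { (refl , c) → refl , Equivalence.from (successor-shift i j (t v w)) c })
  twist-preserves t anti Cₛ (inj₁ _) (inj₂ _) _ _ = ⇔.refl
  twist-preserves t anti Cₛ (inj₂ _) (inj₁ _) _ _ = ⇔.refl
  twist-preserves t anti Cₛ (inj₂ _) (inj₂ _) _ _ = ⇔.refl
  twist-preserves t anti Iₛ (inj₁ (((v , w) , _) , i)) (inj₁ (_ , j)) _ _ =
    mk⇔ (λ { (refl , c) → refl , Equivalence.to (inverse-shift i j (anti v w)) c })
        (λ { (refl , c) → refl , Equivalence.from (inverse-shift i j (anti v w)) c })
  twist-preserves t anti Iₛ (inj₁ _) (inj₂ _) _ _ = ⇔.refl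
  twist-preserves t anti Iₛ (inj₂ _) (inj₁ _) _ _ = ⇔.refl
  twist-preserves t anti Iₛ (inj₂ _) (inj₂ _) _ _ = ⇔.refl
  twist-preserves t anti Rₛ (inj₁ _) (inj₁ _) _ _ = ⇔.refl
  twist-preserves t anti Rₛ (inj₁ _) (inj₂ _) _ _ = ⇔.refl
  twist-preserves t anti Rₛ (inj₂ (v , ρ , _)) (inj₁ (((_ , w) , vw) , i)) _ _ =
    mk⇔ (λ { (refl , c) → refl , trans (cong (_⊕ t v w) c) (sym (lookup-shiftRow-edge v (t v) ρ w vw)) })
        (λ { (refl , c) → refl , ⊕-cancelʳ (t v w) (trans c (lookup-shiftRow-edge v (t v) ρ w vw)) })
  twist-preserves t anti Rₛ (inj₂ _) (inj₂ _) _ _ = ⇔.refl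

-- Moving charge along paths: a twist supported on a path from u to r which
-- changes the balance by c at u and by -c at r, and nowhere else.
module PathTwist {n : ℕ} (G : Graph n) (q : ℕ) .{{_ : NonZero q}} where
  open Modular q
  open Twisting G q
  open MonoidSolver commutativeMonoid using (solve; _⊜_) renaming (_⊕_ to _⊞_)

  edgeTwist : Fin n → Fin n → ℕ → Twist
  edgeTwist u w c a b = δ a u (δ b w c) + δ a w (δ b u (negate c))

  edgeTwist-antisymmetric : ∀ u w c → Antisymmetric (edgeTwist u w c)
  edgeTwist-antisymmetric u w c a b = begin
    (δ a u (δ b w c) + δ a w (δ b u (negate c))) + (δ b u (δ a w c) + δ b w (δ a u (negate c)))
      ≡⟨ cong₂ (λ x y → (δ a u (δ b w c) + δ a w (δ b u (negate c))) + (x + y))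
               (δ-comm a w b u c) (δ-comm a u b w (negate c)) ⟩
    (δ a u (δ b w c) + δ a w (δ b u (negate c))) + (δ a w (δ b u c) + δ a u (δ b w (negate c)))
      ≈⟨ solve 4 (λ x y z t → (x ⊞ y) ⊞ (z ⊞ t) ⊜ (x ⊞ t) ⊞ (z ⊞ y)) refl
               (δ a u (δ b w c)) (δ a w (δ b u (negate c))) (δ a w (δ b u c)) (δ a u (δ b w (negate c))) ⟩
    (δ a u (δ b w c) + δ a u (δ b w (negate c))) + (δ a w (δ b u c) + δ a w (δ b u (negate c)))
      ≈⟨ +-cong-≈ (cancels a u b w) (cancels a w b u) ⟩
    0 ∎
    where
    open ≈-Reasoning
    cancels : ∀ a u b w → δ a u (δ b w c) + δ a u (δ b w (negate c)) ≈ 0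
    cancels a u b w = δ-inverse a u _ _ (δ-inverse b w c (negate c) (negate-inverseʳ c))

  ∂-row : ∀ v u w c → adj G u w ≡ true → ∂ v (λ b → δ v u (δ b w c)) ≈ δ v u c
  ∂-row v u w c uw with v Fin.≟ u
  ... | yes refl = ∂-δ v w c uw
  ... | no _ = ∂-zero v (λ _ → refl)

  ∂-edgeTwist : ∀ u w c → adj G u w ≡ true → ∀ v → ∂ v (edgeTwist u w c v) ≈ δ v u c + δ v w (negate c)
  ∂-edgeTwist u w c uw v = trans (∂-+ v _ _)
    (+-cong-≈ (∂-row v u w c uw) (∂-row v w u (negate c) (trans (Graph.sym G w u) uw)))

  pathTwist : ∀ {S u r} → ℕ → PathAvoiding G S u r → Twist
  pathTwist c here = λ _ _ → 0
  pathTwist c (step {u} {w} _ _ rest) = λ a b → pathTwist c rest a b + edgeTwist u w c a b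

  pathTwist-antisymmetric : ∀ {S u r} c (p : PathAvoiding G S u r) → Antisymmetric (pathTwist c p)
  pathTwist-antisymmetric c here a b = refl
  pathTwist-antisymmetric c (step {u} {w} _ _ rest) a b = begin
    (pathTwist c rest a b + edgeTwist u w c a b) + (pathTwist c rest b a + edgeTwist u w c b a)
      ≈⟨ interchange (pathTwist c rest a b) _ _ _ ⟩
    (pathTwist c rest a b + pathTwist c rest b a) + (edgeTwist u w c a b + edgeTwist u w c b a)
      ≈⟨ +-cong-≈ (pathTwist-antisymmetric c rest a b) (edgeTwist-antisymmetric u w c a b) ⟩
    0 ∎
    where open ≈-Reasoning

  -- telescoping: each inner vertex of the path receives c and -c
  ∂-pathTwist : ∀ {S u r} c (p : PathAvoiding G S u r) v →
    ∂ v (pathTwist c p v) ≈ δ v u c + δ v r (negate c)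
  ∂-pathTwist c here v = trans (∂-zero v (λ _ → refl)) (sym (δ-inverse v _ c (negate c) (negate-inverseʳ c)))
  ∂-pathTwist {r = r} c (step {u} {w} uw _ rest) v = begin
    ∂ v (λ b → pathTwist c rest v b + edgeTwist u w c v b)
      ≈⟨ ∂-+ v (pathTwist c rest v) _ ⟩
    ∂ v (pathTwist c rest v) + ∂ v (edgeTwist u w c v)
      ≈⟨ +-cong-≈ (∂-pathTwist c rest v) (∂-edgeTwist u w c uw v) ⟩
    (δ v w c + δ v r (negate c)) + (δ v u c + δ v w (negate c))
      ≈⟨ solve 4 (λ x y z t → (x ⊞ y) ⊞ (z ⊞ t) ⊜ (z ⊞ y) ⊞ (x ⊞ t)) refl
               (δ v w c) (δ v r (negate c)) (δ v u c) (δ v w (negate c)) ⟩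
    (δ v u c + δ v r (negate c)) + (δ v w c + δ v w (negate c))
      ≈⟨ +-cong-≈ {δ v u c + δ v r (negate c)} refl (δ-inverse v w c (negate c) (negate-inverseʳ c)) ⟩
    (δ v u c + δ v r (negate c)) + 0
      ≡⟨ ℕₚ.+-identityʳ _ ⟩
    δ v u c + δ v r (negate c) ∎
    where open ≈-Reasoning

  pathTwist-avoids : ∀ {S u r} c (p : PathAvoiding G S u r) v → v ∈ S → u ∉ S → ∀ b → pathTwist c p v b ≡ 0
  pathTwist-avoids c here v v∈S u∉S b = refl
  pathTwist-avoids c (step {u} {w} _ w∉S rest) v v∈S u∉S b =
    cong₂ _+_ (pathTwist-avoids c rest v v∈S w∉S b)
      (cong₂ _+_ (δ-≢ _ (λ v≡u → u∉S (subst (_∈ _) v≡u v∈S))) (δ-≢ _ (λ v≡w → w∉S (subst (_∈ _) v≡w v∈S))))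

-- A position of
-- the argument is a set P of pebbled variables, an antisymmetric twist t and
-- assignments α, β such that t maps each pebbled α y to β y.  A counting
-- quantifier over x is handled by the bijection which twists every node a by a
-- repair of t at the vertex of a: this needs the pebbles other than x to sit
-- on at most K vertices, around which the charge is rerouted.
module Invariance {n : ℕ} (G : Graph n) (q : ℕ) .{{_ : NonZero q}} (d d* : Fin n → Fin q) (K : ℕ)
  (robust : ∀ (S : Subset n) → ∣ S ∣ ≤ K → ConnectedWithout G S) (large : suc K < n) where
  open Modular q
  open Twisting G q
  open PathTwist G q

  k : ℕ
  k = suc K

  A B : Structure
  A = CFI G q d
  B = CFI G q d*

  Matched : Subset k → Twist → (Fin k → CFIUniv G q d) → (Fin k → CFIUniv G q d*) → Set
  Matched P t α β = ∀ y → y ∈ P → Σ (Balanced d d* t (vertexOf (α y))) λ p → β y ≡ twist t (α y) p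

  record Repair (t : Twist) (S : Subset n) (u : Fin n) : Set where
    field
      repaired      : Twist
      antisymmetric : Antisymmetric repaired
      balanced      : Balanced d d* repaired u
      agrees        : ∀ v → v ∈ S → ∀ w → repaired v w ≡ t v w

  -- If t is balanced on at most K vertices S, the missing charge at any other
  -- vertex u can be pushed along a path avoiding S to a vertex r ∉ S ∪ {u}.
  repair : ∀ t → Antisymmetric t → (S : Subset n) → ∣ S ∣ ≤ K → (∀ v → v ∈ S → Balanced d d* t v) →
    ∀ u → Repair t S u
  repair t anti S ∣S∣≤K S-balanced u with (toℕ (d u) + ∂ u (t u)) % q ℕ.≟ toℕ (d* u) % q
  ... | yes balanced = record { repaired = t ; antisymmetric = anti ; balanced = balanced ; agrees = λ _ _ _ → refl }
  ... | no unbalanced = record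
    { repaired = t′
    ; antisymmetric = λ a b → trans (interchange (t a b) _ _ _)
                        (+-cong-≈ (anti a b) (pathTwist-antisymmetric c path a b))
    ; balanced = balanced
    ; agrees = λ v v∈S w → trans (cong (t v w +_) (pathTwist-avoids c path v v∈S u∉S w)) (ℕₚ.+-identityʳ _)
    }
    where
    u∉S : u ∉ S
    u∉S u∈S = unbalanced (S-balanced u u∈S)
    fresh : Σ (Fin n) λ r → r ∉ S × u ≢ r
    fresh = ∃∉-both S u (ℕₚ.≤-<-trans (ℕ.s≤s ∣S∣≤K) large)
    r : Fin n
    r = proj₁ fresh
    r∉S : r ∉ S
    r∉S = proj₁ (proj₂ fresh)
    u≢r : u ≢ r
    u≢r = proj₂ (proj₂ fresh)
    path : PathAvoiding G S u r
    path = robust S ∣S∣≤K u r u∉S r∉S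
    charge : ℕ
    charge = toℕ (d u) + ∂ u (t u)
    -- the charge missing at u
    c : ℕ
    c = toℕ (d* u) + negate charge
    t′ : Twist
    t′ a b = t a b + pathTwist c path a b
    δ-at-u : δ u u c + δ u r (negate c) ≡ c
    δ-at-u with u Fin.≟ u
    ... | yes _ = trans (cong (c +_) (δ-≢ (negate c) u≢r)) (ℕₚ.+-identityʳ c)
    ... | no u≢u = contradiction refl u≢u
    balanced : Balanced d d* t′ u
    balanced = begin
      toℕ (d u) + ∂ u (t′ u)                              ≈⟨ +-cong-≈ {toℕ (d u)} refl (∂-+ u (t u) _) ⟩
      toℕ (d u) + (∂ u (t u) + ∂ u (pathTwist c path u))  ≡⟨ ℕₚ.+-assoc (toℕ (d u)) _ _ ⟨
      charge + ∂ u (pathTwist c path u)                   ≈⟨ +-cong-≈ {charge} refl (∂-pathTwist c path u) ⟩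
      charge + (δ u u c + δ u r (negate c))               ≡⟨ cong (charge +_) δ-at-u ⟩
      charge + (toℕ (d* u) + negate charge)               ≈⟨ x∙yz≈y∙xz charge (toℕ (d* u)) _ ⟩
      toℕ (d* u) + (charge + negate charge)               ≈⟨ +-cong-≈ {toℕ (d* u)} refl (negate-inverseʳ charge) ⟩
      toℕ (d* u) + 0                                      ≡⟨ ℕₚ.+-identityʳ _ ⟩
      toℕ (d* u)                                          ∎
      where open ≈-Reasoning

  module Quantifier (P : Subset k) (t : Twist) (anti : Antisymmetric t)
    (α : Fin k → CFIUniv G q d) (β : Fin k → CFIUniv G q d*) (matched : Matched P t α β) (x : Fin k) where

    S : Subset n
    S = image (vertexOf ∘ α) (P - x)

    S-small : ∣ S ∣ ≤ K
    S-small = ℕₚ.≤-trans (∣image∣≤∣p∣ (vertexOf ∘ α) (P - x)) (ℕ.s≤s⁻¹ (∣p-x∣<n P x))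

    S-balanced : ∀ v → v ∈ S → Balanced d d* t v
    S-balanced v v∈S with image-∈⁻ (vertexOf ∘ α) (P - x) v∈S
    ... | y , y∈P-x , refl = proj₁ (matched y (Subsetₚ.p─q⊆p P ⁅ x ⁆ y∈P-x))

    R : ∀ u → Repair t S u
    R = repair t anti S S-small S-balanced

    T : Fin n → Twist
    T u = Repair.repaired (R u)

    T-balanced : ∀ u → Balanced d d* (T u) u
    T-balanced u = Repair.balanced (R u)

    T⁻¹-balanced : ∀ u → Balanced d* d (negateTwist (T u)) u
    T⁻¹-balanced u = balanced-negate {d} {d*} (T u) u (T-balanced u)

    F : CFIUniv G q d → CFIUniv G q d*
    F a = twist {d} {d*} (T (vertexOf a)) a (T-balanced (vertexOf a))

    F⁻¹ : CFIUniv G q d* → CFIUniv G q d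
    F⁻¹ b = twist {d*} {d} (negateTwist (T (vertexOf b))) b (T⁻¹-balanced (vertexOf b))

    F⁻¹∘F : ∀ a → F⁻¹ (F a) ≡ a
    -- (the cases make the vertex of the image reduce to the vertex v of a)
    F⁻¹∘F a@(inj₁ (((v , _) , _) , _)) =
      twist-inverse {d} {d*} (T v) _ (λ _ _ → negate-inverseʳ _) a (T-balanced v) (T⁻¹-balanced v)
    F⁻¹∘F a@(inj₂ (v , _)) =
      twist-inverse {d} {d*} (T v) _ (λ _ _ → negate-inverseʳ _) a (T-balanced v) (T⁻¹-balanced v)

    F∘F⁻¹ : ∀ b → F (F⁻¹ b) ≡ b
    F∘F⁻¹ b@(inj₁ (((v , _) , _) , _)) =
      twist-inverse {d*} {d} _ (T v) (λ _ _ → negate-inverseˡ _) b (T⁻¹-balanced v) (T-balanced v)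
    F∘F⁻¹ b@(inj₂ (v , _)) =
      twist-inverse {d*} {d} _ (T v) (λ _ _ → negate-inverseˡ _) b (T⁻¹-balanced v) (T-balanced v)

    π : CFIUniv G q d ↔ CFIUniv G q d*
    π = mk↔ₛ′ F F⁻¹ F∘F⁻¹ F⁻¹∘F

    matched-update : ∀ a → Matched (P ∪ ⁅ x ⁆) (T (vertexOf a)) (update α x a) (update β x (F a))
    matched-update a y y∈P′ with x Fin.≟ y
    ... | yes refl = T-balanced (vertexOf a) , refl
    ... | no x≢y = balanced-cong {d} {d*} {t} {T (vertexOf a)} agree (proj₁ (matched y y∈P)) ,
                   trans (proj₂ (matched y y∈P)) (twist-cong {d} {d*} t (T (vertexOf a)) (α y) _ _ agree)
      where
      y∈P : y ∈ P
      y∈P with Subsetₚ.x∈p∪q⁻ P ⁅ x ⁆ y∈P′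
      ... | inj₁ y∈P = y∈P
      ... | inj₂ y∈⁅x⁆ = contradiction (sym (Subsetₚ.x∈⁅y⁆⇒x≡y x y∈⁅x⁆)) x≢y
      agree : ∀ w → t (vertexOf (α y)) w ≡ T (vertexOf a) (vertexOf (α y)) w
      agree w = sym (Repair.agrees (R (vertexOf a)) _
                  (∈-image (vertexOf ∘ α) (Subsetₚ.x∈p∧x≢y⇒x∈p-y y∈P (x≢y ∘ sym))) w)

  preserved : ∀ (φ : Form k) P t α β → Antisymmetric t → Matched P t α β → (∀ y → Free y φ → y ∈ P) →
    Sat A α φ ⇔ Sat B β φ
  preserved (atom s x y) P t α β anti matched free
    with matched x (free x (atomˡ refl)) | matched y (free y (atomʳ refl))
  ... | px , βx≡ | py , βy≡ rewrite βx≡ | βy≡ = twist-preserves t anti s (α x) (α y) px py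
  preserved (eq x y) P t α β anti matched free
    with matched x (free x (eqˡ refl)) | matched y (free y (eqʳ refl))
  ... | px , βx≡ | py , βy≡ rewrite βx≡ | βy≡ = mk⇔ (twist-resp t px py) (twist-injective t (α x) (α y) px py)
  preserved (neg φ) P t α β anti matched free =
    mk⇔ (λ ¬sat-A sat-B → ¬sat-A (Equivalence.from ih sat-B)) (λ ¬sat-B sat-A → ¬sat-B (Equivalence.to ih sat-A))
    where
    ih : Sat A α φ ⇔ Sat B β φ
    ih = preserved φ P t α β anti matched (λ y → free y ∘ negF)
  preserved (conj φ) P t α β anti matched free =
    mk⇔ (λ sat-A i → Equivalence.to (ih i) (sat-A i)) (λ sat-B i → Equivalence.from (ih i) (sat-B i))
    where
    ih : ∀ i → Sat A α (φ i) ⇔ Sat B β (φ i)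
    ih i = preserved (φ i) P t α β anti matched (λ y → free y ∘ conjF i)
  preserved (cnt m x φ) P t α β anti matched free =
    cnt-transport A B α β m x φ π λ a →
      preserved φ (P ∪ ⁅ x ⁆) (T (vertexOf a)) (update α x a) (update β x (F a))
        (Repair.antisymmetric (R (vertexOf a))) (matched-update a) free′
    where
    open Quantifier P t anti α β matched x
    free′ : ∀ y → Free y φ → y ∈ P ∪ ⁅ x ⁆
    free′ y free-y with y Fin.≟ x
    ... | yes refl = Subsetₚ.x∈p∪q⁺ (inj₂ (Subsetₚ.x∈⁅x⁆ x))
    ... | no y≢x = Subsetₚ.x∈p∪q⁺ (inj₁ (free y (cntF y≢x free-y)))

  equivalent : A ≡C[ k ] B
  equivalent φ sentence α β =
    Equivalence.to sat , Equivalence.from sat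
    where
    sat : Sat A α φ ⇔ Sat B β φ
    sat = preserved φ ⊥ (λ _ _ → 0) α β (λ _ _ → refl) (λ y y∈⊥ → contradiction y∈⊥ Subsetₚ.∉⊥)
            (λ y free-y → contradiction free-y (sentence y))

-- A self-map σ of a set ranked by rk, which preserves and reflects the order
-- of ranks and hits every rank, fixes all ranks: a finite linear order has
-- no nontrivial automorphism.
rank-fixed : ∀ {X : Set} (rk : X → ℕ) (σ : X → X) →
  (∀ a b → (rk a ≤ rk b) ⇔ (rk (σ a) ≤ rk (σ b))) → (∀ b → Σ X λ a → rk (σ a) ≡ rk b) →
  ∀ a → rk (σ a) ≡ rk a
rank-fixed rk σ monotone hits a = fixed a (On.wellFounded rk <-wellFounded a)
  where
  fixed : ∀ a → Acc (λ x y → rk x < rk y) a → rk (σ a) ≡ rk a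
  fixed a (acc below) with ℕₚ.<-cmp (rk (σ a)) (rk a)
  ... | tri≈ _ σa≡a _ = σa≡a
  ... | tri< σa<a _ _ = contradiction
        (Equivalence.from (monotone a (σ a)) (ℕₚ.≤-reflexive (sym (fixed (σ a) (below σa<a)))))
        (ℕₚ.<⇒≱ σa<a)
  ... | tri> _ _ a<σa with hits a
  ...   | g , σg≡a with rk g ℕₚ.<? rk a
  ...     | yes g<a = contradiction (trans (sym (fixed g (below g<a))) σg≡a) (ℕₚ.<⇒≢ g<a)
  ...     | no g≮a = contradiction
            (ℕₚ.≤-trans (Equivalence.to (monotone a g) (ℕₚ.≮⇒≥ g≮a)) (ℕₚ.≤-reflexive σg≡a))
            (ℕₚ.<⇒≱ a<σa)

module EdgeRank {n : ℕ} (G : Graph n) (q : ℕ) .{{_ : NonZero q}} where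

  rank : DirEdge G q → ℕ
  rank ((v , w) , _) = toℕ v * n + toℕ w

  lex-strict : ∀ (v v′ w w′ : Fin n) → v Fin.< v′ → toℕ v * n + toℕ w < toℕ v′ * n + toℕ w′
  lex-strict v v′ w w′ v<v′ = begin-strict
    toℕ v * n + toℕ w    <⟨ ℕₚ.+-monoʳ-< (toℕ v * n) (Finₚ.toℕ<n w) ⟩
    toℕ v * n + n        ≡⟨ ℕₚ.+-comm (toℕ v * n) n ⟩
    suc (toℕ v) * n      ≤⟨ ℕₚ.*-monoˡ-≤ n v<v′ ⟩
    toℕ v′ * n           ≤⟨ ℕₚ.m≤m+n (toℕ v′ * n) (toℕ w′) ⟩
    toℕ v′ * n + toℕ w′  ∎
    where open ℕₚ.≤-Reasoning

  EdgeLe⇔rank : ∀ e f → EdgeLe G q e f ⇔ (rank e ≤ rank f)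
  EdgeLe⇔rank ((v , w) , _) ((v′ , w′) , _) = mk⇔ to from
    where
    to : v Fin.< v′ ⊎ (v ≡ v′ × w Fin.≤ w′) → toℕ v * n + toℕ w ≤ toℕ v′ * n + toℕ w′
    to (inj₁ v<v′) = ℕₚ.<⇒≤ (lex-strict v v′ w w′ v<v′)
    to (inj₂ (refl , w≤w′)) = ℕₚ.+-monoʳ-≤ (toℕ v * n) w≤w′
    from : toℕ v * n + toℕ w ≤ toℕ v′ * n + toℕ w′ → v Fin.< v′ ⊎ (v ≡ v′ × w Fin.≤ w′)
    from le with Finₚ.<-cmp v v′
    ... | tri< v<v′ _ _ = inj₁ v<v′
    ... | tri≈ _ refl _ = inj₂ (refl , ℕₚ.+-cancelˡ-≤ (toℕ v * n) _ _ le)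
    ... | tri> _ _ v′<v = contradiction le (ℕₚ.<⇒≱ (lex-strict v′ v w′ w v′<v))

  rank-injective : ∀ e f → rank e ≡ rank f → proj₁ e ≡ proj₁ f
  rank-injective ((v , w) , _) ((v′ , w′) , _) same with Finₚ.<-cmp v v′
  ... | tri< v<v′ _ _ = contradiction same (ℕₚ.<⇒≢ (lex-strict v v′ w w′ v<v′))
  ... | tri≈ _ refl _ = cong (v ,_) (Finₚ.toℕ-injective (ℕₚ.+-cancelˡ-≡ (toℕ v * n) _ _ same))
  ... | tri> _ _ v′<v = contradiction (sym same) (ℕₚ.<⇒≢ (lex-strict v′ v w′ w v′<v))

-- An isomorphism π : CFI(G, d) ≅ CFI(G, d*) maps edge nodes to edge nodes
-- (they are the nodes in the relation C) and preserves ≼, hence by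
-- rank-fixed it maps each edge node e_0 to a node e_c of the same edge.
module Rigidity {n : ℕ} (G : Graph n) (q : ℕ) .{{_ : NonZero q}} (d d* : Fin n → Fin q)
  (π : CFI G q d ≅ CFI G q d*) where
  open Modular q
  open EdgeRank G q

  A B : Structure
  A = CFI G q d
  B = CFI G q d*

  to : CFIUniv G q d → CFIUniv G q d*
  to = Inverse.to (_≅_.bij π)

  from : CFIUniv G q d* → CFIUniv G q d
  from = Inverse.from (_≅_.bij π)

  to∘from : ∀ b → to (from b) ≡ b
  to∘from = Inverse.strictlyInverseˡ (_≅_.bij π)

  preserve : ∀ s a b → rel A s a b → rel B s (to a) (to b)
  preserve s a b = Equivalence.to (_≅_.preserves π s a b)

  reflect : ∀ s a b → rel B s (to a) (to b) → rel A s a b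
  reflect s a b = Equivalence.from (_≅_.preserves π s a b)

  next : Fin q → Fin q
  next i = fromℕ< (m%n<n (suc (toℕ i)) q)

  -- exactly the edge nodes are related by C, so π maps edge nodes to edge nodes
  C-next : ∀ {d} e i → rel (CFI G q d) Cₛ (inj₁ (e , i)) (inj₁ (e , next i))
  C-next e i = refl , Finₚ.toℕ-fromℕ< (m%n<n (suc (toℕ i)) q)

  C-edge : ∀ {d} (z z′ : CFIUniv G q d) → rel (CFI G q d) Cₛ z z′ → Σ (DirEdge G q × Fin q) λ y → z ≡ inj₁ y
  C-edge (inj₁ y) (inj₁ _) _ = y , refl

  node : DirEdge G q → CFIUniv G q d
  node e = inj₁ (e , 0ᶠ)

  image-edge : ∀ e → Σ (DirEdge G q × Fin q) λ y → to (node e) ≡ inj₁ y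
  image-edge e = C-edge (to (node e)) _ (preserve Cₛ (node e) (inj₁ (e , next 0ᶠ)) (C-next {d} e 0ᶠ))

  preimage-edge : ∀ y → Σ (DirEdge G q × Fin q) λ x → to (inj₁ x) ≡ inj₁ y
  preimage-edge (f , i) with C-edge (from (inj₁ (f , i))) (from (inj₁ (f , next i)))
    (reflect Cₛ _ _ (subst₂ (rel B Cₛ) (sym (to∘from _)) (sym (to∘from _)) (C-next {d*} f i)))
  ... | x , from≡x = x , trans (cong to (sym from≡x)) (to∘from _)

  σ : DirEdge G q → DirEdge G q
  σ e = proj₁ (proj₁ (image-edge e))

  -- π preserves and reflects ≼ between images, hence induces an automorphism of
  -- the order of the edge classes which is onto
  ≼-images : ∀ {a b a′ b′} → to a ≡ a′ → to b ≡ b′ → rel A ≼ₛ a b ⇔ rel B ≼ₛ a′ b′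
  ≼-images {a} {b} refl refl = _≅_.preserves π ≼ₛ a b

  σ-monotone : ∀ e f → (rank e ≤ rank f) ⇔ (rank (σ e) ≤ rank (σ f))
  σ-monotone e f = ⇔.trans (⇔.sym (EdgeLe⇔rank e f))
    (⇔.trans (≼-images (proj₂ (image-edge e)) (proj₂ (image-edge f))) (EdgeLe⇔rank (σ e) (σ f)))

  σ-hits : ∀ f → Σ (DirEdge G q) λ g → rank (σ g) ≡ rank f
  σ-hits f with preimage-edge (f , 0ᶠ)
  ... | (g , i) , to≡ = g , ℕₚ.≤-antisym
      (Equivalence.to (EdgeLe⇔rank (σ g) f) (Equivalence.to (≼-images (proj₂ (image-edge g)) to≡) g≤g))
      (Equivalence.to (EdgeLe⇔rank f (σ g)) (Equivalence.to (≼-images to≡ (proj₂ (image-edge g))) g≤g))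
    where
    g≤g : EdgeLe G q g g
    g≤g = inj₂ (refl , Finₚ.≤-refl)

  dirEdge-≡ : ∀ {e f : DirEdge G q} → proj₁ e ≡ proj₁ f → e ≡ f
  dirEdge-≡ {_ , p} {_ , p′} refl = cong (_ ,_) (UIP.Decidable⇒UIP.≡-irrelevant Boolₚ._≟_ p p′)

  edge-image : ∀ e → Σ (Fin q) λ c → to (node e) ≡ inj₁ (e , c)
  edge-image e = proj₂ (proj₁ (image-edge e)) ,
    trans (proj₂ (image-edge e)) (cong (λ f → inj₁ (f , proj₂ (proj₁ (image-edge e)))) (dirEdge-≡ (rank-injective (σ e) e σ-fixed)))
    where
    σ-fixed : rank (σ e) ≡ rank e
    σ-fixed = rank-fixed rank σ σ-monotone σ-hits e

R-edge : ∀ {n} {G : Graph n} {q} .{{_ : NonZero q}} {d} (z : CFIUniv G q d) e i →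
  rel (CFI G q d) Rₛ z (inj₁ (e , i)) →
  Σ (EqNode G q d) λ en → z ≡ inj₂ en × proj₁ en ≡ proj₁ (proj₁ e) × i ≡ lookup (proj₁ (proj₂ en)) (proj₂ (proj₁ e))
R-edge (inj₂ en) e i (source≡ , i≡) = en , refl , sym source≡ , i≡

-- The charge is an isomorphism invariant: if CFI(G, 0) ≅ CFI(G, d) and every
-- vertex has a neighbour, then Σ_v d(v) ≈ 0.  The images of the zero equation
-- nodes assign residues f v w to the edges; I makes f antisymmetric, and the
-- equation at v says that the row sum of f at v is d(v).
module ChargeInvariance {n : ℕ} (G : Graph n) (q : ℕ) .{{_ : NonZero q}} (d : Fin n → Fin q)
  (π : CFI G q (λ _ → Modular.0ᶠ q) ≅ CFI G q d) (neighbour : ∀ v → Σ (Fin n) λ w → adj G v w ≡ true) where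
  open Modular q
  open Rigidity G q (λ _ → 0ᶠ) d π

  label : DirEdge G q → ℕ
  label e = toℕ (proj₁ (edge-image e))

  -- I relates e_0 and (e⁻¹)_0, so the labels of e and e⁻¹ cancel
  label-antisymmetric : ∀ v w vw wv → label ((v , w) , vw) + label ((w , v) , wv) ≈ 0
  label-antisymmetric v w vw wv = Equivalence.to %≡0⇔≈0 (proj₂ (subst₂ (rel B Iₛ)
    (proj₂ (edge-image ((v , w) , vw))) (proj₂ (edge-image ((w , v) , wv)))
    (preserve Iₛ (node ((v , w) , vw)) (node ((w , v) , wv)) (refl , I-zero))))
    where
    I-zero : (toℕ 0ᶠ + toℕ 0ᶠ) % q ≡ 0
    I-zero = trans (cong₂ (λ x y → (x + y) % q) toℕ-0ᶠ toℕ-0ᶠ) 0%q≡0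

  zeroRow : Vec (Fin q) n
  zeroRow = tabulate λ _ → 0ᶠ

  lookup-zeroRow : ∀ w → toℕ (lookup zeroRow w) ≡ 0
  lookup-zeroRow w = trans (cong toℕ (lookup∘tabulate (λ _ → 0ᶠ) w)) toℕ-0ᶠ

  offZero-zeroRow : ∀ v → offZero G q v zeroRow ≡ true
  offZero-zeroRow v = Equivalence.to Boolₚ.T-≡ (Allₚ.all⁻ _ (All.universal entry-zero (allFin n)))
    where
    entry-zero : ∀ w → Data.Bool.T (adj G v w ∨ (toℕ (lookup zeroRow w) ℕ.≡ᵇ 0))
    entry-zero w = Equivalence.from Boolₚ.T-∨ (inj₂ (subst (λ m → Data.Bool.T (m ℕ.≡ᵇ 0)) (sym (lookup-zeroRow w)) tt))

  sumE-zeroRow : ∀ v → sumE G q v zeroRow % q ≡ toℕ 0ᶠ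
  sumE-zeroRow v = Equivalence.from (%≡toℕ⇔≈ 0ᶠ) (begin
    sumE G q v zeroRow                                            ≡⟨ listSum-allFin n _ ⟩
    ∑[ w < n ] (if adj G v w then toℕ (lookup zeroRow w) else 0)  ≈⟨ ∑-cong entry-zero ⟩
    ∑[ w < n ] 0                                                  ≈⟨ ∑-zero n ⟩
    0                                                             ≡⟨ toℕ-0ᶠ ⟨
    toℕ 0ᶠ                                                        ∎)
    where
    open ≈-Reasoning
    entry-zero : ∀ w → (if adj G v w then toℕ (lookup zeroRow w) else 0) ≈ 0
    entry-zero w with adj G v w
    ... | true = cong (_% q) (lookup-zeroRow w)
    ... | false = refl

  zeroNode : Fin n → CFIUniv G q (λ _ → 0ᶠ)
  zeroNode v = inj₂ (v , zeroRow , offZero-zeroRow v , sumE-zeroRow v)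

  R-zeroNode : ∀ v w vw → rel A Rₛ (zeroNode v) (node ((v , w) , vw))
  R-zeroNode v w vw = refl , Finₚ.toℕ-injective (trans toℕ-0ᶠ (sym (lookup-zeroRow w)))

  R-image : ∀ v w vw → rel B Rₛ (to (zeroNode v)) (inj₁ (((v , w) , vw) , proj₁ (edge-image ((v , w) , vw))))
  R-image v w vw = subst (rel B Rₛ (to (zeroNode v))) (proj₂ (edge-image ((v , w) , vw)))
                     (preserve Rₛ (zeroNode v) (node ((v , w) , vw)) (R-zeroNode v w vw))

  record ImageRow (v : Fin n) : Set where
    field
      row       : Vec (Fin q) n
      row-sum   : sumE G q v row % q ≡ toℕ (d v)
      row-label : ∀ w vw → label ((v , w) , vw) ≡ toℕ (lookup row w)

  imageRow : ∀ v → ImageRow v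
  imageRow v with neighbour v
  ... | w₀ , vw₀ with R-edge (to (zeroNode v)) _ _ (R-image v w₀ vw₀)
  ...   | (_ , ρ , _ , sum-ρ) , to≡ρ , refl , _ =
    record { row = ρ ; row-sum = sum-ρ ; row-label = row-label }
    where
    row-label : ∀ w vw → label ((v , w) , vw) ≡ toℕ (lookup ρ w)
    row-label w vw with R-edge (to (zeroNode v)) _ _ (R-image v w vw)
    ... | _ , to≡ρ′ , _ , c≡ρ′w with inj₂-injective (trans (sym to≡ρ′) to≡ρ)
    ... | refl = cong toℕ c≡ρ′w

  entry : Fin n → Fin n → ℕ
  entry v w = toℕ (lookup (ImageRow.row (imageRow v)) w)

  f : Fin n → Fin n → ℕ
  f v w = if adj G v w then entry v w else 0

  f-edge : ∀ v w (vw : adj G v w ≡ true) → f v w ≡ label ((v , w) , vw)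
  f-edge v w vw = trans (cong (λ b → if b then entry v w else 0) vw) (sym (ImageRow.row-label (imageRow v) w vw))

  f-non-edge : ∀ v w → adj G v w ≡ false → f v w ≡ 0
  f-non-edge v w vw = cong (λ b → if b then entry v w else 0) vw

  f-antisymmetric : ∀ v w → f v w + f w v ≈ 0
  f-antisymmetric v w = by-adjacency (adj G v w) refl
    where
    by-adjacency : ∀ b → adj G v w ≡ b → f v w + f w v ≈ 0
    by-adjacency true vw = subst (_≈ 0) (sym (cong₂ _+_ (f-edge v w vw) (f-edge w v wv)))
                             (label-antisymmetric v w vw wv)
      where
      wv : adj G w v ≡ true
      wv = trans (Graph.sym G w v) vw
    by-adjacency false vw = cong (_% q) (cong₂ _+_ (f-non-edge v w vw) (f-non-edge w v (trans (Graph.sym G w v) vw)))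

  row-sum : ∀ v → ∑[ w < n ] f v w ≈ toℕ (d v)
  row-sum v = trans (cong (_% q) (sym (listSum-allFin n _)))
                    (Equivalence.to (%≡toℕ⇔≈ (d v)) (ImageRow.row-sum (imageRow v)))

  charge-vanishes : ∑[ v < n ] toℕ (d v) ≈ 0
  charge-vanishes = begin
    ∑[ v < n ] toℕ (d v)           ≈⟨ ∑-cong (λ v → sym (row-sum v)) ⟩
    ∑[ v < n ] ∑[ w < n ] f v w    ≈⟨ ∑∑-antisymmetric n f f-antisymmetric (λ v → cong (_% q) (f-non-edge v v (Graph.irrefl G v))) ⟩
    0                              ∎
    where open ≈-Reasoning

has-neighbour : ∀ {n} (G : Graph n) → ConnectedWithout G ⊥ → 1 < n → ∀ v → Σ (Fin n) λ w → adj G v w ≡ true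
has-neighbour {suc zero} G _ (ℕ.s≤s ()) v
has-neighbour {suc (suc m)} G connected _ v = first-step (connected v (other v) Subsetₚ.∉⊥ Subsetₚ.∉⊥) (other-≢ v)
  where
  other : Fin (suc (suc m)) → Fin (suc (suc m))
  other Fin.zero = Fin.suc Fin.zero
  other (Fin.suc _) = Fin.zero
  other-≢ : ∀ v → v ≢ other v
  other-≢ Fin.zero ()
  other-≢ (Fin.suc _) ()
  first-step : ∀ {u r} → PathAvoiding G ⊥ u r → u ≢ r → Σ (Fin (suc (suc m))) λ w → adj G u w ≡ true
  first-step here u≢u = contradiction refl u≢u
  first-step (step uw _ _) _ = _ , uw

unitCharge : ∀ {n q} .{{_ : NonZero q}} → 1 < q → Fin n → Fin n → Fin q
unitCharge {q = q} 1<q v₀ v = if does (v Fin.≟ v₀) then fromℕ< 1<q else Modular.0ᶠ q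

-- CFI(G, 0) and CFI(G, 1_{v₀}) have total charges 0 and 1, so they are not isomorphic.
cfi-not-isomorphic : ∀ {n} (G : Graph n) q .{{_ : NonZero q}} (1<q : 1 < q) →
  (∀ v → Σ (Fin n) λ w → adj G v w ≡ true) → ∀ v₀ →
  ¬ (CFI G q (λ _ → Modular.0ᶠ q) ≅ CFI G q (unitCharge 1<q v₀))
cfi-not-isomorphic {n} G q 1<q neighbour v₀ π =
  contradiction (trans (sym (m<n⇒m%n≡m 1<q)) (trans one≈zero 0%q≡0)) λ ()
  where
  open Modular q
  total-is-one : ∑[ v < n ] toℕ (unitCharge 1<q v₀ v) ≈ 1
  total-is-one = trans (∑-cong {y = λ v → δ v v₀ 1} unit-is-δ) (∑-δ v₀ 1)
    where
    unit-is-δ : ∀ v → toℕ (unitCharge 1<q v₀ v) ≈ δ v v₀ 1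
    unit-is-δ v with v Fin.≟ v₀
    ... | yes _ = cong (_% q) (Finₚ.toℕ-fromℕ< 1<q)
    ... | no _ = cong (_% q) toℕ-0ᶠ
  one≈zero : 1 ≈ 0
  one≈zero = trans (sym total-is-one) (ChargeInvariance.charge-vanishes G q (unitCharge 1<q v₀) π neighbour)

cfi-equivalent : ∀ {n} (G : Graph n) q .{{_ : NonZero q}} k → 1 ≤ k → ConGreater G k →
  ∀ d d* → CFI G q d ≡C[ k ] CFI G q d*
cfi-equivalent G q (suc K) _ (c , (_ , (c<n , robust) , _) , k<c) d d* =
  Invariance.equivalent G q d d* K (λ S ∣S∣≤K → robust S (ℕₚ.≤-trans ∣S∣≤K K≤c)) (ℕₚ.<-trans k<c c<n)
  where
  K≤c : K ≤ c
  K≤c = ℕₚ.≤-trans (ℕₚ.n≤1+n K) (ℕₚ.<⇒≤ k<c)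

-- Theorem 9, second part: a class with con ∈ ω(1) contains, for every k, a graph
-- G with con(G) > k; then CFI(G, 0) and CFI(G, 1_{v₀}) are C^k-equivalent but
-- not isomorphic.
cfi-separating-pair : ∀ q .{{_ : NonZero q}} → 1 < q → (𝔊 : GraphClass) → ConOmega1 𝔊 → (k : ℕ) → 1 ≤ k →
  Σ ℕ λ n → Σ (Graph n) λ G → Σ (Fin n → Fin q) λ d →
  Σ ℕ λ m → Σ (Graph m) λ H → Σ (Fin m → Fin q) λ e →
    𝔊 n G × 𝔊 m H × ¬ (CFI G q d ≅ CFI H q e) × (CFI G q d ≡C[ k ] CFI H q e)
cfi-separating-pair q 1<q 𝔊 (unbounded , eventually-connected) k 1≤k with eventually-connected k
... | N , con>k-from-N with unbounded N
...   | n , N≤n , G , G∈𝔊 with con>k-from-N n N≤n G G∈𝔊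
...     | con>k@(c , (_ , (c<n , robust) , _) , k<c) =
  n , G , (λ _ → Modular.0ᶠ q) , n , G , unitCharge 1<q v₀ , G∈𝔊 , G∈𝔊 ,
  cfi-not-isomorphic G q 1<q neighbour v₀ , cfi-equivalent G q k 1≤k con>k _ _
  where
  1<n : 1 < n
  1<n = ℕₚ.≤-<-trans 1≤k (ℕₚ.<-trans k<c c<n)
  neighbour : ∀ v → Σ (Fin n) λ w → adj G v w ≡ true
  neighbour = has-neighbour G (robust ⊥ (ℕₚ.≤-trans (ℕₚ.≤-reflexive (Subsetₚ.∣⊥∣≡0 n)) ℕ.z≤n)) 1<n
  v₀ : Fin n
  v₀ = fromℕ< (ℕₚ.<-trans (ℕ.s≤s ℕ.z≤n) 1<n)

mainTheorem9 : (q : ℕ) → (pq : Prime q) →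
    ((k n : ℕ) → 1 ≤ k → (G : Graph n) → ConGreater G k →
      (d d* : Fin n → Fin q) →
      CFI G q {{prime⇒nonZero pq}} d ≡C[ k ] CFI G q {{prime⇒nonZero pq}} d*)
    ×
    ((𝔊 : GraphClass) → ConOmega1 𝔊 → (k : ℕ) → 1 ≤ k →
      Σ ℕ λ n → Σ (Graph n) λ G → Σ (Fin n → Fin q) λ d →
      Σ ℕ λ m → Σ (Graph m) λ H → Σ (Fin m → Fin q) λ e →
        𝔊 n G × 𝔊 m H ×
        ¬ (CFI G q {{prime⇒nonZero pq}} d ≅ CFI H q {{prime⇒nonZero pq}} e) ×
        (CFI G q {{prime⇒nonZero pq}} d ≡C[ k ] CFI H q {{prime⇒nonZero pq}} e))
mainTheorem9 q pq =
  (λ k n 1≤k G → cfi-equivalent G q k 1≤k) , cfi-separating-pair q (ℕ.nonTrivial⇒n>1 q {{prime⇒nonTrivial pq}})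
  where
  instance
    q≢0 : NonZero q
    q≢0 = prime⇒nonZero pq
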